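{- Let $n\geq 9$ and let $\mathcal{M}(n)$ be the number of sets $\{x_1,\dots,x_n\}$ of $n$ pairwise distinct positive integers with $\frac{1}{x_1}+\dots+\frac{1}{x_n}=1$ such that there is an odd prime $q$ with every $x_i$ of the form $2^{a_i}q^{b_i}$, $a_i\in\{0,1,2\}$, $b_i\geq 0$. Then $$\mathcal{M}(n)=tri(n)+sq(n)+ast(n)+dia(n)+St1(n)+St2(n)+St(n)+\begin{cases}2&\text{if $n$ is odd},\\ 1&\text{if $n$ is even},\end{cases}$$ where the integer sequences are those defined in the context.
   Context: Let $\delta_{n=k}$ equal $1$ if $n=k$ and $0$ otherwise. The integer sequences $tri,sq,ast,dia,St1,St2,St,t,p$, indexed by integers $n\geq 3$, are determined by the initial values $tri(3)=1$ and $dia(3)=sq(3)=ast(3)=St(3)=St2(3)=St1(3)=t(3)=p(3)=dia(4)=St(4)=St2(4)=St1(4)=t(4)=p(4)=St(5)=St2(5)=St1(5)=St2(6)=St(6)=St2(7)=St(7)=0$, together with the recurrences (valid for every $n$ whose value is not fixed by an initial value above): $ast(n)=ast(n-1)+dia(n-1)+\delta_{n=4}$; $tri(n)=tri(n-1)+sq(n-1)+St1(n-1)+St2(n-1)+St(n-1)$; $sq(n)=ast(n-1)+dia(n-1)$; $dia(n)=tri(n-2)+sq(n-2)+St1(n-2)+St2(n-2)+St(n-2)$; $St1(n)=ast(n-3)+dia(n-3)+\delta_{n=6}$; $St2(n)=ast(n-5)+dia(n-5)+t(n-5)+p(n-5)+\delta_{n=8}$; $St(n)=tri(n-5)+sq(n-5)+St1(n-5)+St2(n-5)+St(n-5)$;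 $t(n)=ast(n-2)+dia(n-2)+t(n-2)+p(n-2)+\delta_{n=5}$; $p(n)=tri(n-2)+sq(n-2)+St1(n-2)+St2(n-2)+St(n-2)$. Solutions are counted as unordered sets. -}

module Defs where

open import Data.Nat using (ℕ; zero; suc; _+_; _*_; _^_; _≤_; _<_; _≡ᵇ_; _%_)
open import Data.Bool using (if_then_else_)
open import Data.List using (List; []; _∷_; length)
open import Data.List.Relation.Unary.All using (All)
open import Data.List.Relation.Unary.Linked using (Linked)
open import Data.Integer using (+_)
open import Data.Rational using (ℚ; _/_; 0ℚ; 1ℚ) renaming (_+_ to _+ℚ_)
open import Data.Nat.Primality using (Prime)
open import Data.Product using (Σ; _×_; ∃; ∃-syntax)
open import Relation.Binary.PropositionalEquality using (_≡_)

δ : ℕ → ℕ → ℕ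
δ n k = if n ≡ᵇ k then 1 else 0

-- The nine sequences of the context, indexed by the actual n.
-- Values at n < 3 are never used (set to 0).  The recurrences are applied
-- exactly at those n ≥ 3 whose value is not fixed by an initial value.
mutual
  tri : ℕ → ℕ
  tri 0 = 0
  tri 1 = 0
  tri 2 = 0
  tri 3 = 1
  tri (suc m) = tri m + sq m + St1 m + St2 m + St m

  sq : ℕ → ℕ
  sq 0 = 0
  sq 1 = 0
  sq 2 = 0
  sq 3 = 0
  sq (suc m) = ast m + dia m

  ast : ℕ → ℕ
  ast 0 = 0
  ast 1 = 0
  ast 2 = 0
  ast 3 = 0
  ast (suc m) = ast m + dia m + δ (suc m) 4

  dia : ℕ → ℕ
  dia 0 = 0
  dia 1 = 0
  dia 2 = 0
  dia 3 = 0
  dia 4 = 0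
  dia (suc (suc m)) = tri m + sq m + St1 m + St2 m + St m

  St1 : ℕ → ℕ
  St1 0 = 0
  St1 1 = 0
  St1 2 = 0
  St1 3 = 0
  St1 4 = 0
  St1 5 = 0
  St1 (suc (suc (suc m))) = ast m + dia m + δ (3 + m) 6

  St2 : ℕ → ℕ
  St2 0 = 0
  St2 1 = 0
  St2 2 = 0
  St2 3 = 0
  St2 4 = 0
  St2 5 = 0
  St2 6 = 0
  St2 7 = 0
  St2 (suc (suc (suc (suc (suc m))))) = ast m + dia m + t m + p m + δ (5 + m) 8

  St : ℕ → ℕ
  St 0 = 0
  St 1 = 0
  St 2 = 0
  St 3 = 0
  St 4 = 0
  St 5 = 0
  St 6 = 0
  St 7 = 0
  St (suc (suc (suc (suc (suc m))))) = tri m + sq m + St1 m + St2 m + St m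

  t : ℕ → ℕ
  t 0 = 0
  t 1 = 0
  t 2 = 0
  t 3 = 0
  t 4 = 0
  t (suc (suc m)) = ast m + dia m + t m + p m + δ (2 + m) 5

  p : ℕ → ℕ
  p 0 = 0
  p 1 = 0
  p 2 = 0
  p 3 = 0
  p 4 = 0
  p (suc (suc m)) = tri m + sq m + St1 m + St2 m + St m

parityTerm : ℕ → ℕ
parityTerm n = if n % 2 ≡ᵇ 1 then 2 else 1

formula : ℕ → ℕ
formula n = tri n + sq n + ast n + dia n + St1 n + St2 n + St n + parityTerm n

-- reciprocal 1/x of a natural number as a rational (only used for x > 0)
recip : ℕ → ℚ
recip zero = 0ℚ
recip (suc k) = (+ 1) / suc k

sumRecip : List ℕ → ℚ
sumRecip [] = 0ℚ
sumRecip (x ∷ xs) = recip x +ℚ sumRecip xs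

IsForm : ℕ → ℕ → Set
IsForm q x = ∃[ a ] ∃[ b ] (a ≤ 2 × x ≡ 2 ^ a * q ^ b)

-- A set {x_1,…,x_n} of n pairwise distinct positive integers is represented
-- canonically by the strictly increasing list of its elements.
IsSolution : ℕ → List ℕ → Set
IsSolution n xs =
  length xs ≡ n
  × Linked _<_ xs
  × All (0 <_) xs
  × sumRecip xs ≡ 1ℚ
  × (∃[ q ] (Prime q × q % 2 ≡ 1 × All (IsForm q) xs))

-- Let q be the odd prime, B the largest exponent of q in a solution and D = 4 q^B. Grouping
-- the elements 2^a q^k (a ≤ 2) by k turns a solution with n elements into a string of digits
-- d_0 … d_B of total weight n, where d_k records which a occur at level k; its value
-- v(d_k) = Σ 2^(2-a) ≤ 7 is the share of level k in Σ D/x = D, so Σ_k v(d_k) q^(B-k) = 4 q^B.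
-- Read from k = 0, this is a run of an automaton on residues: from residue R a digit of value
-- v ≤ R leads to q (R - v), and the run ends exactly when the residue reaches 0. As a level
-- consumes at most 7, every residue satisfies R (q - 1) ≤ 7 q. For q ≥ 9 this leaves only
-- one-digit runs from 4; for q = 5 and q = 7 the runs are forced and give the parity term;
-- for q = 3 the residues 3, 6, 9 form a three-state automaton whose number of runs of weight n
-- satisfies the same linear recurrence of order six as tri + sq + ast + dia + St1 + St2 + St,
-- and the two agree for n = 7, …, 12.

{-# OPTIONS --safe #-}
module Submission where

open import Defs
open import Data.Bool using (Bool; true; false; T)
open import Data.Bool.Properties using () renaming (_≟_ to _≟ᵇ_)
open import Data.Empty using (⊥; ⊥-elim)
open import Data.List using (List; []; _∷_; _++_; map; length)
import Data.List.Base as L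
open import Data.List.Properties using (length-++; length-map; map-++; map-∘; map-cong; ∷-injectiveʳ)
open import Data.List.Membership.Propositional using (_∈_)
open import Data.List.Membership.Propositional.Properties using (∈-++⁻; ∈-++⁺ˡ; ∈-++⁺ʳ; ∈-map⁺; ∈-map⁻)
open import Data.List.Membership.Propositional.Properties.WithK using (unique∧set⇒bag)
open import Data.List.Relation.Binary.BagAndSetEquality using (∼bag⇒↭)
open import Data.List.Relation.Binary.Permutation.Propositional using (_↭_; ↭-sym; ↭-trans; ↭⇒↭ₛ)
open import Data.List.Relation.Binary.Permutation.Propositional.Properties using (∈-resp-↭; ↭-length)
import Data.List.Relation.Binary.Permutation.Propositional.Properties as Permutation
open import Data.List.Relation.Binary.Pointwise using (Pointwise-≡⇒≡)
open import Data.List.Relation.Unary.All as All using (All; []; _∷_)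
import Data.List.Relation.Unary.All.Properties as All
import Data.List.Relation.Unary.AllPairs as AllPairs
open import Data.List.Relation.Unary.Any using (here; there)
open import Data.List.Relation.Unary.Linked as Linked using (Linked)
import Data.List.Relation.Unary.Linked.Properties as Linked
open import Data.List.Relation.Unary.Sorted.TotalOrder.Properties using (↗↭↗⇒≋)
open import Data.List.Relation.Unary.Unique.Propositional using (Unique; []; _∷_)
import Data.List.Relation.Unary.Unique.Propositional.Properties as Unique
open import Data.Nat
open import Data.Nat.Properties
open import Data.Nat.DivMod using (n/1≡n; m*n/n≡m; m*n%n≡0; %-distribˡ-*; m*n/m*o≡n/o)
open import Data.Nat.Divisibility using (_∣_; _∣?_; divides; *-pres-∣; m∣m*n)
open import Data.Nat.ListAction using (sum)
open import Data.Nat.ListAction.Properties using (sum-++; sum-↭)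
open import Data.Nat.Primality using (Prime; prime?; prime⇒nonTrivial)
open import Data.Nat.Tactic.RingSolver using (solve-∀; solve)
open import Data.Product using (Σ; ∃; ∃₂; _×_; _,_; proj₁; proj₂)
open import Data.Product.Properties using (≡-dec)
open import Data.Rational using (1ℚ)
open import Data.Sum using (inj₁; inj₂)
open import Data.Unit using (tt)
open import Function using (case_of_)
open import Function.Bundles using (_⇔_; mk⇔; Equivalence)
import Function.Properties.Equivalence as ⇔
open import Relation.Binary.Definitions using (DecidableEquality; tri<; tri≈; tri>)
open import Relation.Binary.PropositionalEquality
open import Relation.Nullary using (¬_; contradiction)
open import Relation.Nullary.Decidable using (True; isYes; toWitness; fromWitness; from-yes; from-no)
open import Algebra.Properties.CommutativeSemigroup *-commutativeSemigroup using (x∙yz≈y∙xz)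
open import Data.List.Membership.DecPropositional _≟_ using (_∈?_)
open import Data.List.Relation.Binary.Permutation.Setoid.Properties (setoid ℕ) using (Unique-resp-↭)
open import Data.List.Sort ≤-decTotalOrder using (sort; sort-↭; sort-↗)

-- The digit at level k says which of q^k, 2 q^k, 4 q^k lie in the set; dᵥ is the digit of value v.
Digit : Set
Digit = Bool × Bool × Bool

pattern d₀ = false , false , false
pattern d₁ = false , false , true
pattern d₂ = false , true , false
pattern d₃ = false , true , true
pattern d₄ = true , false , false
pattern d₅ = true , false , true
pattern d₆ = true , true , false
pattern d₇ = true , true , true

χ : Bool → ℕ
χ true = 1
χ false = 0

value : Digit → ℕ
value (a , b , c) = 4 * χ a + 2 * χ b + χ c

weight : Digit → ℕ
weight (a , b , c) = χ a + χ b + χ c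

bit : Digit → ℕ → Bool
bit (a , _ , _) 0 = a
bit (_ , b , _) 1 = b
bit (_ , _ , c) 2 = c
bit _ _ = false

_≟ᵈ_ : DecidableEquality Digit
_≟ᵈ_ = ≡-dec _≟ᵇ_ (≡-dec _≟ᵇ_ _≟ᵇ_)

open import Data.List.Relation.Unary.Unique.DecPropositional _≟ᵈ_ using (unique?)

χ≤1 : ∀ b → χ b ≤ 1
χ≤1 true = s≤s z≤n
χ≤1 false = z≤n

value≤7 : ∀ d → value d ≤ 7
value≤7 (a , b , c) = +-mono-≤ (+-mono-≤ (*-monoʳ-≤ 4 (χ≤1 a)) (*-monoʳ-≤ 2 (χ≤1 b))) (χ≤1 c)

weight≤3 : ∀ d → weight d ≤ 3
weight≤3 (a , b , c) = +-mono-≤ (+-mono-≤ (χ≤1 a) (χ≤1 b)) (χ≤1 c)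

bit⇒≤2 : ∀ d a → T (bit d a) → a ≤ 2
bit⇒≤2 d 0 _ = z≤n
bit⇒≤2 d 1 _ = s≤s z≤n
bit⇒≤2 d 2 _ = s≤s (s≤s z≤n)

d₀-empty : ∀ a → ¬ T (bit d₀ a)
d₀-empty 0 ()
d₀-empty 1 ()
d₀-empty 2 ()
d₀-empty (suc (suc (suc _))) ()

bit⇒value>0 : ∀ d a → T (bit d a) → 0 < value d
bit⇒value>0 (true , _ , _) _ _ = s≤s z≤n
bit⇒value>0 (false , true , _) _ _ = s≤s z≤n
bit⇒value>0 (false , false , true) _ _ = s≤s z≤n
bit⇒value>0 (false , false , false) a t = ⊥-elim (d₀-empty a t)

T-ext : ∀ {a b} → (T a → T b) → (T b → T a) → a ≡ b
T-ext {true} {true} _ _ = refl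
T-ext {true} {false} f _ = ⊥-elim (f tt)
T-ext {false} {true} _ g = ⊥-elim (g tt)
T-ext {false} {false} _ _ = refl

digit-ext : ∀ {d d′} → (∀ a → T (bit d a) ⇔ T (bit d′ a)) → d ≡ d′
digit-ext bits = cong₂ _,_ (ext 0) (cong₂ _,_ (ext 1) (ext 2))
  where ext = λ a → T-ext (Equivalence.to (bits a)) (Equivalence.from (bits a))

-- The residue automaton

-- Run q R w ds: read from level 0, the digits ds take the residue R to 0; w is their weight.
data Run (q : ℕ) : ℕ → ℕ → List Digit → Set where
  done : Run q 0 0 []
  step : ∀ {R d r w ds} → value d + r ≡ suc R → Run q (r * q) w ds →
         Run q (suc R) (weight d + w) (d ∷ ds)

run⇒weight : ∀ {q R w ds} → Run q R w ds → w ≡ sum (map weight ds)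
run⇒weight done = refl
run⇒weight (step {d = d} _ run) = cong (weight d +_) (run⇒weight run)

residue-bound : ∀ p r → r * suc p * p ≤ 7 * suc p → r * p ≤ 7
residue-bound p r le = *-cancelˡ-≤ (suc p) (begin
  suc p * (r * p) ≡⟨ regroup p r ⟩
  r * suc p * p   ≤⟨ le ⟩
  7 * suc p       ≡⟨ *-comm 7 (suc p) ⟩
  suc p * 7       ∎)
  where
  regroup : ∀ p r → suc p * (r * p) ≡ r * suc p * p
  regroup = solve-∀
  open ≤-Reasoning

run-bounded : ∀ {p R w ds} → Run (suc p) R w ds → R * p ≤ 7 * suc p
run-bounded done = z≤n
run-bounded {p} (step {R} {d} {r} e run) = begin
  suc R * p            ≡⟨ cong (_* p) e ⟨
  (value d + r) * p    ≡⟨ *-distribʳ-+ p (value d) r ⟩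
  value d * p + r * p  ≤⟨ +-mono-≤ (*-monoˡ-≤ p (value≤7 d)) (residue-bound p r (run-bounded run)) ⟩
  7 * p + 7            ≡⟨ trans (+-comm (7 * p) 7) (sym (*-suc 7 p)) ⟩
  7 * suc p            ∎
  where open ≤-Reasoning

unreachable : ∀ {p R w ds} → Run (suc p) R w ds → {_ : True (7 * suc p <? R * p)} → ⊥
unreachable run {lt} = <⇒≱ (toWitness lt) (run-bounded run)

large-base-weight : ∀ {p w ds} → 8 ≤ p → Run (suc p) 4 w ds → w ≤ 3
large-base-weight _ (step {d = d} {zero} _ done) = ≤-trans (≤-reflexive (+-identityʳ (weight d))) (weight≤3 d)
large-base-weight {p} 8≤p (step {r = suc r} _ run) =
  contradiction (≤-trans (m≤n*m p (suc r)) (residue-bound p (suc r) (run-bounded run))) (<⇒≱ 8≤p)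

eval : ℕ → List Digit → ℕ
eval q [] = 0
eval q (d ∷ ds) = value d * q ^ length ds + eval q ds

horner-step : ∀ q v Q e → v * (q * Q) + q * e ≡ q * (v * Q + e)
horner-step = solve-∀

run⇒eval : ∀ {q R w ds} → Run q R w ds → q * eval q ds ≡ R * q ^ length ds
run⇒eval {q} done = *-zeroʳ q
run⇒eval {q} (step {R} {d} {r} {ds = ds} e run) = begin
  q * (value d * Q + eval q ds)      ≡⟨ horner-step q (value d) Q (eval q ds) ⟨
  value d * (q * Q) + q * eval q ds  ≡⟨ cong (value d * (q * Q) +_) (run⇒eval run) ⟩
  value d * (q * Q) + r * q * Q      ≡⟨ cong (value d * (q * Q) +_) (*-assoc r q Q) ⟩
  value d * (q * Q) + r * (q * Q)    ≡⟨ *-distribʳ-+ (q * Q) (value d) r ⟨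
  (value d + r) * (q * Q)            ≡⟨ cong (_* (q * Q)) e ⟩
  suc R * (q * Q)                    ∎
  where
  Q = q ^ length ds
  open ≡-Reasoning

data LastNonzero : List Digit → Set where
  []  : LastNonzero []
  [_] : ∀ {d} → 0 < value d → LastNonzero (d ∷ [])
  _∷_ : ∀ d {e ds} → LastNonzero (e ∷ ds) → LastNonzero (d ∷ e ∷ ds)

LastNonzero-tail : ∀ {d ds} → LastNonzero (d ∷ ds) → LastNonzero ds
LastNonzero-tail [ _ ] = []
LastNonzero-tail (_ ∷ ln) = ln

eval>0 : ∀ {q d ds} .{{_ : NonZero q}} → LastNonzero (d ∷ ds) → 0 < eval q (d ∷ ds)
eval>0 {q} {d} [ v>0 ] = ≤-trans (*-monoˡ-≤ 1 v>0) (m≤m+n (value d * 1) 0)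
eval>0 {q} {d} {ds} (_ ∷ ln) = ≤-trans (eval>0 ln) (m≤n+m (eval q ds) (value d * q ^ length ds))

split-residue : ∀ {v E R M} → 0 < M → v * M + E ≡ R * M → v ≤ R × E ≡ (R ∸ v) * M
split-residue {v} {E} {R} {M} M>0 eq = v≤R , (begin
  E                    ≡⟨ m+n∸m≡n (v * M) E ⟨
  v * M + E ∸ v * M    ≡⟨ cong (_∸ v * M) eq ⟩
  R * M ∸ v * M        ≡⟨ *-distribʳ-∸ M R v ⟨
  (R ∸ v) * M          ∎)
  where
  instance _ = >-nonZero M>0
  v≤R = *-cancelʳ-≤ v R M (subst (v * M ≤_) eq (m≤m+n (v * M) E))
  open ≡-Reasoning

eval⇒run : ∀ {q R ds} .{{_ : NonZero q}} → LastNonzero ds → q * eval q ds ≡ R * q ^ length ds →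
           Run q R (sum (map weight ds)) ds
eval⇒run {q} {R} [] eq with trans (sym (*-identityʳ R)) (trans (sym eq) (*-zeroʳ q))
... | refl = done
eval⇒run {q} {zero} {d ∷ ds} ln eq =
  contradiction (m*n≡0⇒m≡0 _ q (trans (*-comm _ q) eq)) (>⇒≢ (eval>0 ln))
eval⇒run {q} {suc R} {d ∷ ds} ln eq = step (m+[n∸m]≡n v≤R) (eval⇒run (LastNonzero-tail ln) tail-eq)
  where
  Q = q ^ length ds
  v≤R×rest = split-residue {v = value d} (m^n>0 q (suc (length ds))) (trans (horner-step q (value d) Q (eval q ds)) eq)
  v≤R = proj₁ v≤R×rest
  tail-eq : q * eval q ds ≡ (suc R ∸ value d) * q * Q
  tail-eq = trans (proj₂ v≤R×rest) (sym (*-assoc (suc R ∸ value d) q Q))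

digitAt : List Digit → ℕ → Digit
digitAt [] _ = d₀
digitAt (d ∷ _) zero = d
digitAt (_ ∷ ds) (suc k) = digitAt ds k

eval-zeros : ∀ q ds → (∀ k → digitAt ds k ≡ d₀) → eval q ds ≡ 0
eval-zeros q [] _ = refl
eval-zeros q (d ∷ ds) zeros rewrite zeros 0 = eval-zeros q ds (λ k → zeros (suc k))

run-nonzero : ∀ {q R w ds} .{{_ : NonZero q}} → Run q (suc R) w ds → ¬ (∀ k → digitAt ds k ≡ d₀)
run-nonzero {q} {R} {ds = ds} run zeros
  with m*n≡0⇒m≡0 (suc R) (q ^ length ds) {{m^n≢0 q (length ds)}}
         (trans (sym (run⇒eval run)) (trans (cong (q *_) (eval-zeros q ds zeros)) (*-zeroʳ q)))
... | ()

run-injective : ∀ {q R R′ w w′ ds ds′} .{{_ : NonZero q}} → Run q R w ds → Run q R′ w′ ds′ →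
                (∀ k → digitAt ds k ≡ digitAt ds′ k) → ds ≡ ds′
run-injective done done _ = refl
run-injective done run′@(step _ _) same = ⊥-elim (run-nonzero run′ (λ k → sym (same k)))
run-injective run@(step _ _) done same = ⊥-elim (run-nonzero run same)
run-injective (step _ run) (step _ run′) same =
  cong₂ _∷_ (same 0) (run-injective run run′ (λ k → same (suc k)))

when : Bool → ℕ → List ℕ
when true x = x ∷ []
when false x = []

level : Digit → List ℕ
level (a , b , c) = when a 1 ++ when b 2 ++ when c 4

elements : ℕ → List Digit → List ℕ
elements q [] = []
elements q (d ∷ ds) = level d ++ map (q *_) (elements q ds)

∈-when⁻ : ∀ {b x y} → x ∈ when b y → T b × x ≡ y
∈-when⁻ {true} (here refl) = tt , refl

∈-level⁻ : ∀ {x} d → x ∈ level d → ∃ λ a → T (bit d a) × x ≡ 2 ^ a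
∈-level⁻ (a , b , c) x∈ with ∈-++⁻ (when a 1) x∈
... | inj₁ x∈₁ = 0 , ∈-when⁻ x∈₁
... | inj₂ x∈′ with ∈-++⁻ (when b 2) x∈′
...   | inj₁ x∈₂ = 1 , ∈-when⁻ x∈₂
...   | inj₂ x∈₄ = 2 , ∈-when⁻ x∈₄

∈-level⁺ : ∀ d a → T (bit d a) → 2 ^ a ∈ level d
∈-level⁺ (true , b , c) 0 _ = here refl
∈-level⁺ (a , true , c) 1 _ = ∈-++⁺ʳ (when a 1) (here refl)
∈-level⁺ (a , b , true) 2 _ = ∈-++⁺ʳ (when a 1) (∈-++⁺ʳ (when b 2) (here refl))

digitAt⇒< : ∀ ds k a → T (bit (digitAt ds k) a) → k < length ds
digitAt⇒< [] k a t = ⊥-elim (d₀-empty a t)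
digitAt⇒< (d ∷ ds) zero a _ = s≤s z≤n
digitAt⇒< (d ∷ ds) (suc k) a t = s≤s (digitAt⇒< ds k a t)

∈-elements⁻ : ∀ {q x} ds → x ∈ elements q ds → ∃₂ λ a k → T (bit (digitAt ds k) a) × x ≡ 2 ^ a * q ^ k
∈-elements⁻ {q} (d ∷ ds) x∈ with ∈-++⁻ (level d) x∈
... | inj₁ x∈ₗ with ∈-level⁻ d x∈ₗ
...   | a , t , refl = a , 0 , t , sym (*-identityʳ (2 ^ a))
∈-elements⁻ {q} (d ∷ ds) x∈ | inj₂ x∈ₘ with ∈-map⁻ (q *_) x∈ₘ
...   | y , y∈ , refl with ∈-elements⁻ ds y∈
...     | a , k , t , refl = a , suc k , t , x∙yz≈y∙xz q (2 ^ a) (q ^ k)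

∈-elements⁺ : ∀ q ds k a → T (bit (digitAt ds k) a) → 2 ^ a * q ^ k ∈ elements q ds
∈-elements⁺ q [] k a t = ⊥-elim (d₀-empty a t)
∈-elements⁺ q (d ∷ ds) zero a t = ∈-++⁺ˡ (subst (_∈ level d) (sym (*-identityʳ (2 ^ a))) (∈-level⁺ d a t))
∈-elements⁺ q (d ∷ ds) (suc k) a t = ∈-++⁺ʳ (level d)
  (subst (_∈ map (q *_) (elements q ds)) (x∙yz≈y∙xz q (2 ^ a) (q ^ k)) (∈-map⁺ (q *_) (∈-elements⁺ q ds k a t)))

length-level : ∀ d → length (level d) ≡ weight d
length-level (a , b , c) = begin
  length (when a 1 ++ when b 2 ++ when c 4)                    ≡⟨ length-++ (when a 1) ⟩
  length (when a 1) + length (when b 2 ++ when c 4)            ≡⟨ cong (length (when a 1) +_) (length-++ (when b 2)) ⟩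
  length (when a 1) + (length (when b 2) + length (when c 4))  ≡⟨ +-assoc (length (when a 1)) _ _ ⟨
  length (when a 1) + length (when b 2) + length (when c 4)
    ≡⟨ cong₂ _+_ (cong₂ _+_ (length-when a) (length-when b)) (length-when c) ⟩
  χ a + χ b + χ c                                              ∎
  where
  length-when : ∀ b {x} → length (when b x) ≡ χ b
  length-when true = refl
  length-when false = refl
  open ≡-Reasoning

length-elements : ∀ q ds → length (elements q ds) ≡ sum (map weight ds)
length-elements q [] = refl
length-elements q (d ∷ ds) = trans (length-++ (level d))
  (cong₂ _+_ (length-level d) (trans (length-map (q *_) (elements q ds)) (length-elements q ds)))

2^a∣4 : ∀ a → a ≤ 2 → 2 ^ a ∣ 4
2^a∣4 0 _ = divides 4 refl
2^a∣4 1 _ = divides 2 refl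
2^a∣4 2 _ = divides 1 refl
2^a∣4 (suc (suc (suc _))) (s≤s (s≤s ()))

^-monoʳ-∣ : ∀ q {k L} → k ≤ L → q ^ k ∣ q ^ L
^-monoʳ-∣ q {k} k≤L with m≤n⇒∃[o]m+o≡n k≤L
... | t , refl = subst (q ^ k ∣_) (sym (^-distribˡ-+-* q k t)) (m∣m*n (q ^ t))

elements-divide : ∀ q ds {x} → x ∈ elements q ds → x ∣ 4 * q ^ length ds
elements-divide q ds x∈ with ∈-elements⁻ ds x∈
... | a , k , t , refl = *-pres-∣ (2^a∣4 a (bit⇒≤2 _ a t)) (^-monoʳ-∣ q (<⇒≤ (digitAt⇒< ds k a t)))

-- Division with the junk value m ÷ 0 = 0, so that it can be mapped over a list of numbers.
_÷_ : ℕ → ℕ → ℕ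
m ÷ zero = 0
m ÷ suc n = m / suc n

÷-cancelˡ : ∀ q m n → 0 < q → (q * m) ÷ (q * n) ≡ m ÷ n
÷-cancelˡ q m zero _ rewrite *-zeroʳ q = refl
÷-cancelˡ (suc q) m (suc n) _ = m*n/m*o≡n/o (suc q) m (suc n)

sum-map-++ : ∀ (f : ℕ → ℕ) xs ys → sum (map f (xs ++ ys)) ≡ sum (map f xs) + sum (map f ys)
sum-map-++ f xs ys = trans (cong sum (map-++ f xs ys)) (sum-++ (map f xs) (map f ys))

sum-level : ∀ d Q → sum (map ((4 * Q) ÷_) (level d)) ≡ value d * Q
sum-level (a , b , c) Q = begin
  sum (map f (when a 1 ++ when b 2 ++ when c 4))                          ≡⟨ sum-map-++ f (when a 1) _ ⟩
  sum (map f (when a 1)) + sum (map f (when b 2 ++ when c 4))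
    ≡⟨ cong (sum (map f (when a 1)) +_) (sum-map-++ f (when b 2) _) ⟩
  sum (map f (when a 1)) + (sum (map f (when b 2)) + sum (map f (when c 4)))
    ≡⟨ cong₂ _+_ (sum-when a) (cong₂ _+_ (sum-when b) (sum-when c)) ⟩
  χ a * f 1 + (χ b * f 2 + χ c * f 4)
    ≡⟨ cong₂ (λ x y → χ a * x + (χ b * y + χ c * f 4)) (n/1≡n (4 * Q)) f2 ⟩
  χ a * (4 * Q) + (χ b * (2 * Q) + χ c * f 4)
    ≡⟨ cong (λ z → χ a * (4 * Q) + (χ b * (2 * Q) + χ c * z)) f4 ⟩
  χ a * (4 * Q) + (χ b * (2 * Q) + χ c * Q)                               ≡⟨ collect (χ a) (χ b) (χ c) Q ⟩
  value (a , b , c) * Q                                                   ∎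
  where
  f = (4 * Q) ÷_
  sum-when : ∀ b {x} → sum (map f (when b x)) ≡ χ b * f x
  sum-when true = refl
  sum-when false = refl
  f2 : f 2 ≡ 2 * Q
  f2 = trans (cong (_/ 2) (double Q)) (m*n/n≡m (2 * Q) 2)
    where
    double : ∀ Q → 4 * Q ≡ 2 * Q * 2
    double = solve-∀
  f4 : f 4 ≡ Q
  f4 = trans (cong (_/ 4) (*-comm 4 Q)) (m*n/n≡m Q 4)
  collect : ∀ a b c Q → a * (4 * Q) + (b * (2 * Q) + c * Q) ≡ (4 * a + 2 * b + c) * Q
  collect = solve-∀
  open ≡-Reasoning

sum-elements : ∀ q ds → 0 < q → sum (map ((4 * q ^ length ds) ÷_) (elements q ds)) ≡ q * eval q ds
sum-elements q [] _ = sym (*-zeroʳ q)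
sum-elements q (d ∷ ds) q>0 = begin
  sum (map (D ÷_) (level d ++ map (q *_) es))                    ≡⟨ sum-map-++ (D ÷_) (level d) _ ⟩
  sum (map (D ÷_) (level d)) + sum (map (D ÷_) (map (q *_) es))  ≡⟨ cong₂ _+_ (sum-level d (q * Q)) (cong sum shift) ⟩
  value d * (q * Q) + sum (map ((4 * Q) ÷_) es)                  ≡⟨ cong (value d * (q * Q) +_) (sum-elements q ds q>0) ⟩
  value d * (q * Q) + q * eval q ds                              ≡⟨ horner-step q (value d) Q (eval q ds) ⟩
  q * eval q (d ∷ ds)                                            ∎
  where
  Q = q ^ length ds
  D = 4 * (q * Q)
  es = elements q ds
  shift : map (D ÷_) (map (q *_) es) ≡ map ((4 * Q) ÷_) es
  shift = trans (sym (map-∘ es))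
    (map-cong (λ y → trans (cong (_÷ (q * y)) (sym (x∙yz≈y∙xz q 4 Q))) (÷-cancelˡ q (4 * Q) y q>0)) es)
  open ≡-Reasoning

-- Solutions in an odd base

module Reciprocals where
  open import Data.Integer using (+_)
  import Data.Integer as ℤ
  import Data.Integer.Properties as ℤ
  open import Data.Rational using (toℚᵘ)
  import Data.Rational.Properties as ℚ
  open import Data.Rational.Unnormalised using (mkℚᵘ; _≃_; *≡*)
  import Data.Rational.Unnormalised as ℚᵘ
  import Data.Rational.Unnormalised.Properties as ℚᵘ

  unit-fraction-+ : ∀ {x D′ c} s → suc D′ ≡ c * suc x →
                    mkℚᵘ (+ 1) x ℚᵘ.+ mkℚᵘ (+ s) D′ ≃ mkℚᵘ (+ (c + s)) D′
  unit-fraction-+ {x} {D′} {c} s eq = *≡* (begin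
    (+ 1 ℤ.* + D ℤ.+ + s ℤ.* + X) ℤ.* + D  ≡⟨ cong (ℤ._* + D) (cong₂ ℤ._+_ (ℤ.pos-* 1 D) (ℤ.pos-* s X)) ⟨
    (+ (1 * D) ℤ.+ + (s * X)) ℤ.* + D      ≡⟨ cong (ℤ._* + D) (ℤ.pos-+ (1 * D) (s * X)) ⟨
    + (1 * D + s * X) ℤ.* + D              ≡⟨ ℤ.pos-* (1 * D + s * X) D ⟨
    + ((1 * D + s * X) * D)                ≡⟨ cong +_ (cross eq) ⟩
    + ((c + s) * (X * D))                  ≡⟨ ℤ.pos-* (c + s) (X * D) ⟩
    + (c + s) ℤ.* + (X * D)                ∎)
    where
    D = suc D′
    X = suc x
    cross : ∀ {D} → D ≡ c * X → (1 * D + s * X) * D ≡ (c + s) * (X * D)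
    cross refl = regroup c s X
      where
      regroup : ∀ c s X → (1 * (c * X) + s * X) * (c * X) ≡ (c + s) * (X * (c * X))
      regroup = solve-∀
    open ≡-Reasoning

  sumRecip-scaled : ∀ D′ xs → All (_∣ suc D′) xs →
                    toℚᵘ (sumRecip xs) ≃ mkℚᵘ (+ sum (map (suc D′ ÷_) xs)) D′
  sumRecip-scaled D′ [] [] = *≡* refl
  sumRecip-scaled D′ (zero ∷ xs) (divides c eq ∷ _) = contradiction (trans eq (*-zeroʳ c)) λ ()
  sumRecip-scaled D′ (suc x ∷ xs) (divides c eq ∷ xs∣D) =
    ℚᵘ.≃-trans (ℚ.toℚᵘ-homo-+ (recip (suc x)) (sumRecip xs))
    (ℚᵘ.≃-trans (ℚᵘ.+-cong (ℚ.toℚᵘ-fromℚᵘ (mkℚᵘ (+ 1) x)) (sumRecip-scaled D′ xs xs∣D))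
    (ℚᵘ.≃-trans (unit-fraction-+ (sum (map (suc D′ ÷_) xs)) eq)
    (ℚᵘ.≃-reflexive (cong (λ c → mkℚᵘ (+ (c + sum (map (suc D′ ÷_) xs))) D′) quotient))))
    where
    quotient : c ≡ suc D′ / suc x
    quotient = sym (trans (cong (_/ suc x) eq) (m*n/n≡m c (suc x)))

  sumRecip≡1⇔ : ∀ {D} .{{_ : NonZero D}} xs → All (_∣ D) xs → sumRecip xs ≡ 1ℚ ⇔ sum (map (D ÷_) xs) ≡ D
  sumRecip≡1⇔ {zero} _ _ = contradiction refl (≢-nonZero⁻¹ 0)
  sumRecip≡1⇔ {suc D′} xs xs∣D = mk⇔ to from
    where
    S = sum (map (suc D′ ÷_) xs)
    to : sumRecip xs ≡ 1ℚ → S ≡ suc D′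
    to eq with ℚᵘ.≃-trans (ℚᵘ.≃-sym (sumRecip-scaled D′ xs xs∣D)) (ℚ.toℚᵘ-cong eq)
    ... | *≡* eq′ = ℤ.+-injective (trans (sym (ℤ.*-identityʳ (+ S))) (trans eq′ (ℤ.*-identityˡ (+ suc D′))))
    from : S ≡ suc D′ → sumRecip xs ≡ 1ℚ
    from eq = ℚ.toℚᵘ-injective (ℚᵘ.≃-trans (sumRecip-scaled D′ xs xs∣D)
      (*≡* (trans (ℤ.*-identityʳ (+ S)) (trans (cong +_ eq) (sym (ℤ.*-identityˡ (+ suc D′)))))))

open Reciprocals using (sumRecip≡1⇔)

strict⇒unique : ∀ {xs} → Linked _<_ xs → Unique xs
strict⇒unique s = AllPairs.map <⇒≢ (Linked.Linked⇒AllPairs <-trans s)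

sorted∧unique⇒strict : ∀ {xs} → Linked _≤_ xs → Unique xs → Linked _<_ xs
sorted∧unique⇒strict s u =
  Linked.zipWith (λ (x≤y , x≢y) → ≤∧≢⇒< x≤y x≢y) (s , Linked.AllPairs⇒Linked u)

sort-strict : ∀ {xs} → Unique xs → Linked _<_ (sort xs)
sort-strict {xs} u = sorted∧unique⇒strict (sort-↗ xs) (Unique-resp-↭ (↭⇒↭ₛ (↭-sym (sort-↭ xs))) u)

same-members⇒↭ : ∀ {xs ys : List ℕ} → Unique xs → Unique ys → (∀ {x} → x ∈ xs ⇔ x ∈ ys) → xs ↭ ys
same-members⇒↭ u u′ same = ∼bag⇒↭ (unique∧set⇒bag u u′ same)

strict≡sort : ∀ {xs ys} → Linked _<_ xs → xs ↭ ys → xs ≡ sort ys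
strict≡sort {xs} {ys} s xs↭ys = Pointwise-≡⇒≡ (↗↭↗⇒≋ ≤-totalOrder (Linked.map <⇒≤ s) (sort-↗ ys)
  (↭⇒↭ₛ (↭-trans xs↭ys (↭-sym (sort-↭ ys)))))

odd≢even : ∀ {m} n → m % 2 ≡ 1 → m ≢ 2 * n
odd≢even n odd refl = 0≢1+n (trans (sym (trans (cong (_% 2) (*-comm 2 n)) (m*n%n≡0 n 2))) odd)

2^*odd-injective : ∀ a b {m n} → m % 2 ≡ 1 → n % 2 ≡ 1 → 2 ^ a * m ≡ 2 ^ b * n → a ≡ b
2^*odd-injective zero zero _ _ _ = refl
2^*odd-injective zero (suc b) {m} {n} m-odd _ eq =
  contradiction (trans (sym (*-identityˡ m)) (trans eq (*-assoc 2 (2 ^ b) n))) (odd≢even (2 ^ b * n) m-odd)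
2^*odd-injective (suc a) zero {m} {n} _ n-odd eq =
  contradiction (trans (sym (*-identityˡ n)) (trans (sym eq) (*-assoc 2 (2 ^ a) m))) (odd≢even (2 ^ a * m) n-odd)
2^*odd-injective (suc a) (suc b) {m} {n} m-odd n-odd eq = cong suc (2^*odd-injective a b m-odd n-odd
  (*-cancelˡ-≡ (2 ^ a * m) (2 ^ b * n) 2 (trans (sym (*-assoc 2 (2 ^ a) m)) (trans eq (*-assoc 2 (2 ^ b) n)))))

module OddBase {q : ℕ} (q-odd : q % 2 ≡ 1) (1<q : 1 < q) where

  instance
    q≢0 : NonZero q
    q≢0 = >-nonZero (<-trans z<s 1<q)

  odd-power : ∀ b → q ^ b % 2 ≡ 1
  odd-power zero = refl
  odd-power (suc b) = trans (%-distribˡ-* q (q ^ b) 2) (cong₂ (λ u v → (u * v) % 2) q-odd (odd-power b))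

  ^-injective : ∀ {b b′} → q ^ b ≡ q ^ b′ → b ≡ b′
  ^-injective {b} {b′} eq with <-cmp b b′
  ... | tri< b<b′ _ _ = contradiction eq (<⇒≢ (^-monoʳ-< q 1<q b<b′))
  ... | tri≈ _ b≡b′ _ = b≡b′
  ... | tri> _ _ b>b′ = contradiction (sym eq) (<⇒≢ (^-monoʳ-< q 1<q b>b′))

  power-injective : ∀ {a a′ b b′} → 2 ^ a * q ^ b ≡ 2 ^ a′ * q ^ b′ → a ≡ a′ × b ≡ b′
  power-injective {a} {a′} {b} {b′} eq with 2^*odd-injective a a′ (odd-power b) (odd-power b′) eq
  ... | refl = refl , ^-injective (*-cancelˡ-≡ (q ^ b) (q ^ b′) (2 ^ a) {{m^n≢0 2 a}} eq)

  level-unique : ∀ d → Unique (level d)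
  level-unique (a , b , c) =
    Unique.++⁺ (when-unique a) (Unique.++⁺ (when-unique b) (when-unique c) disjoint₂₄) disjoint₁
    where
    when-unique : ∀ b {x} → Unique (when b x)
    when-unique true = [] ∷ []
    when-unique false = []
    disjoint₂₄ : ∀ {x} → ¬ (x ∈ when b 2 × x ∈ when c 4)
    disjoint₂₄ (x∈₂ , x∈₄) with ∈-when⁻ {b} x∈₂ | ∈-when⁻ {c} x∈₄
    ... | _ , refl | _ , ()
    disjoint₁ : ∀ {x} → ¬ (x ∈ when a 1 × x ∈ when b 2 ++ when c 4)
    disjoint₁ (x∈₁ , x∈′) with ∈-when⁻ {a} x∈₁ | ∈-++⁻ (when b 2) x∈′
    ... | _ , refl | inj₁ x∈₂ with () ← proj₂ (∈-when⁻ {b} x∈₂)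
    ... | _ , refl | inj₂ x∈₄ with () ← proj₂ (∈-when⁻ {c} x∈₄)

  elements-unique : ∀ ds → Unique (elements q ds)
  elements-unique [] = []
  elements-unique (d ∷ ds) =
    Unique.++⁺ (level-unique d) (Unique.map⁺ (λ {x} {y} → *-cancelˡ-≡ x y q) (elements-unique ds)) disjoint
    where
    disjoint : ∀ {x} → ¬ (x ∈ level d × x ∈ map (q *_) (elements q ds))
    disjoint (x∈ₗ , x∈ₘ) with ∈-level⁻ d x∈ₗ | ∈-map⁻ (q *_) x∈ₘ
    ... | a , _ , refl | y , y∈ , eq with ∈-elements⁻ ds y∈
    ...   | a′ , k , _ , refl =
      0≢1+n (proj₂ (power-injective {a} {a′} {0} {suc k}
        (trans (*-identityʳ (2 ^ a)) (trans eq (x∙yz≈y∙xz q (2 ^ a′) (q ^ k))))))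

  bit⇔∈elements : ∀ ds k a → T (bit (digitAt ds k) a) ⇔ 2 ^ a * q ^ k ∈ elements q ds
  bit⇔∈elements ds k a = mk⇔ (∈-elements⁺ q ds k a) from
    where
    from : 2 ^ a * q ^ k ∈ elements q ds → T (bit (digitAt ds k) a)
    from x∈ with ∈-elements⁻ ds x∈
    ... | a′ , k′ , t , eq with power-injective {a} {a′} {k} {k′} eq
    ...   | refl , refl = t

  encode : List Digit → List ℕ
  encode ds = sort (elements q ds)

  ∈-encode : ∀ ds {x} → x ∈ encode ds ⇔ x ∈ elements q ds
  ∈-encode ds = mk⇔ (∈-resp-↭ (sort-↭ _)) (∈-resp-↭ (↭-sym (sort-↭ _)))

  encode-injective : ∀ {R R′ w w′ ds ds′} → Run q R w ds → Run q R′ w′ ds′ →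
                     encode ds ≡ encode ds′ → ds ≡ ds′
  encode-injective {ds = ds} {ds′} run run′ eq = run-injective run run′ λ k → digit-ext λ a →
    ⇔.trans (bit⇔∈elements ds k a) (⇔.trans same-elements (⇔.sym (bit⇔∈elements ds′ k a)))
    where
    same-elements : ∀ {x} → x ∈ elements q ds ⇔ x ∈ elements q ds′
    same-elements = ⇔.trans (⇔.sym (∈-encode ds)) (subst (λ l → _ ∈ l ⇔ _) (sym eq) (∈-encode ds′))

  encode-forms : ∀ ds → All (IsForm q) (encode ds)
  encode-forms ds = All.tabulate λ x∈ → case ∈-elements⁻ ds (Equivalence.to (∈-encode ds) x∈) of λ where
    (a , k , t , refl) → a , k , bit⇒≤2 _ a t , refl

  base∈encode : ∀ ds → T (bit (digitAt ds 1) 0) → q ∈ encode ds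
  base∈encode ds t = Equivalence.from (∈-encode ds)
    (subst (_∈ elements q ds) (trans (*-identityˡ (q * 1)) (*-identityʳ q)) (∈-elements⁺ q ds 1 0 t))

  encode-unique : ∀ {R n dss} → All (Run q R n) dss → Unique dss → Unique (map encode dss)
  encode-unique [] [] = []
  encode-unique (run ∷ runs) (ds∉ ∷ unique) =
    All.map⁺ (All.zipWith (λ (ds≢ , run′) eq → ds≢ (encode-injective run run′ eq)) (ds∉ , runs)) ∷
    encode-unique runs unique

  run⇒solution : ∀ {n ds} → Prime q → Run q 4 n ds → IsSolution n (encode ds)
  run⇒solution {n} {ds} q-prime run =
    len , sort-strict (elements-unique ds) , positive , reciprocals , q , q-prime , q-odd , encode-forms ds
    where
    D = 4 * q ^ length ds
    instance
      D≢0 : NonZero D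
      D≢0 = m*n≢0 4 (q ^ length ds) {{_}} {{m^n≢0 q (length ds)}}
    sort↭ = sort-↭ (elements q ds)
    len : length (encode ds) ≡ n
    len = trans (↭-length sort↭) (trans (length-elements q ds) (sym (run⇒weight run)))
    positive : All (0 <_) (encode ds)
    positive = All.tabulate λ x∈ → case ∈-elements⁻ ds (Equivalence.to (∈-encode ds) x∈) of λ where
      (a , k , _ , refl) → *-mono-≤ (m^n>0 2 a) (m^n>0 q k)
    reciprocals : sumRecip (encode ds) ≡ 1ℚ
    reciprocals = Equivalence.from
      (sumRecip≡1⇔ (encode ds) (All.tabulate λ x∈ → elements-divide q ds (Equivalence.to (∈-encode ds) x∈)))
      (begin
        sum (map (D ÷_) (encode ds))      ≡⟨ sum-↭ (Permutation.map⁺ (D ÷_) sort↭) ⟩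
        sum (map (D ÷_) (elements q ds))  ≡⟨ sum-elements q ds (<-trans z<s 1<q) ⟩
        q * eval q ds                     ≡⟨ run⇒eval run ⟩
        D                                 ∎)
      where open ≡-Reasoning

  digitOf : List ℕ → ℕ → Digit
  digitOf xs k = has 0 , has 1 , has 2
    where
    has : ℕ → Bool
    has a = isYes (2 ^ a * q ^ k ∈? xs)

  bit-digitOf : ∀ xs k a → a ≤ 2 → T (bit (digitOf xs k) a) ⇔ 2 ^ a * q ^ k ∈ xs
  bit-digitOf xs k 0 _ = mk⇔ toWitness fromWitness
  bit-digitOf xs k 1 _ = mk⇔ toWitness fromWitness
  bit-digitOf xs k 2 _ = mk⇔ toWitness fromWitness
  bit-digitOf xs k (suc (suc (suc _))) (s≤s (s≤s ()))

  digitsFrom : List ℕ → ℕ → ℕ → List Digit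
  digitsFrom xs j zero = []
  digitsFrom xs j (suc c) = digitOf xs j ∷ digitsFrom xs (suc j) c

  length-digitsFrom : ∀ xs j c → length (digitsFrom xs j c) ≡ c
  length-digitsFrom xs j zero = refl
  length-digitsFrom xs j (suc c) = cong suc (length-digitsFrom xs (suc j) c)

  digitAt-digitsFrom : ∀ xs j c k → k < c → digitAt (digitsFrom xs j c) k ≡ digitOf xs (j + k)
  digitAt-digitsFrom xs j (suc c) zero _ = cong (digitOf xs) (sym (+-identityʳ j))
  digitAt-digitsFrom xs j (suc c) (suc k) (s≤s k<c) =
    trans (digitAt-digitsFrom xs (suc j) c k k<c) (cong (digitOf xs) (sym (+-suc j k)))

  digitsFrom-LastNonzero : ∀ xs j c a → T (bit (digitOf xs (j + c)) a) → LastNonzero (digitsFrom xs j (suc c))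
  digitsFrom-LastNonzero xs j zero a t = [ bit⇒value>0 _ a (subst (λ i → T (bit (digitOf xs i) a)) (+-identityʳ j) t) ]
  digitsFrom-LastNonzero xs j (suc c) a t =
    digitOf xs j ∷ digitsFrom-LastNonzero xs (suc j) c a (subst (λ i → T (bit (digitOf xs i) a)) (+-suc j c) t)

  maxExponent : ∀ {xs} → All (IsForm q) xs → ℕ
  maxExponent [] = 0
  maxExponent ((_ , b , _) ∷ fs) = b ⊔ maxExponent fs

  form-bounded : ∀ {xs} (fs : All (IsForm q) xs) {x} → x ∈ xs →
                 ∃₂ λ a b → a ≤ 2 × b ≤ maxExponent fs × x ≡ 2 ^ a * q ^ b
  form-bounded ((a , b , a≤2 , eq) ∷ fs) (here refl) = a , b , a≤2 , m≤m⊔n b (maxExponent fs) , eq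
  form-bounded ((_ , b , _) ∷ fs) (there x∈) with form-bounded fs x∈
  ... | a , b′ , a≤2 , b′≤ , eq = a , b′ , a≤2 , ≤-trans b′≤ (m≤n⊔m b (maxExponent fs)) , eq

  maxExponent-attained : ∀ {x xs} (fs : All (IsForm q) (x ∷ xs)) →
                         ∃ λ a → a ≤ 2 × 2 ^ a * q ^ maxExponent fs ∈ x ∷ xs
  maxExponent-attained ((a , b , a≤2 , eq) ∷ []) =
    a , a≤2 , here (trans (cong (λ e → 2 ^ a * q ^ e) (⊔-identityʳ b)) (sym eq))
  maxExponent-attained ((a , b , a≤2 , eq) ∷ fs@(_ ∷ _)) with ⊔-sel b (maxExponent fs)
  ... | inj₁ max≡b = a , a≤2 , here (trans (cong (λ e → 2 ^ a * q ^ e) max≡b) (sym eq))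
  ... | inj₂ max≡M with maxExponent-attained fs
  ...   | a′ , a′≤2 , x∈ = a′ , a′≤2 , there (subst (λ e → 2 ^ a′ * q ^ e ∈ _) (sym max≡M) x∈)

  decode : ∀ {xs} → All (IsForm q) xs → List Digit
  decode {xs} fs = digitsFrom xs 0 (suc (maxExponent fs))

  ∈-decode : ∀ {xs} (fs : All (IsForm q) xs) {x} → x ∈ elements q (decode fs) ⇔ x ∈ xs
  ∈-decode {xs} fs = mk⇔ to from
    where
    ds = decode fs
    to : ∀ {x} → x ∈ elements q ds → x ∈ xs
    to x∈ with ∈-elements⁻ ds x∈
    ... | a , k , t , refl = Equivalence.to (bit-digitOf xs k a (bit⇒≤2 _ a t))
      (subst (λ d → T (bit d a)) (digitAt-digitsFrom xs 0 _ k k<) t)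
      where
      k< = subst (k <_) (length-digitsFrom xs 0 _) (digitAt⇒< ds k a t)
    from : ∀ {x} → x ∈ xs → x ∈ elements q ds
    from x∈ with form-bounded fs x∈
    ... | a , b , a≤2 , b≤ , refl = ∈-elements⁺ q ds b a
      (subst (λ d → T (bit d a)) (sym (digitAt-digitsFrom xs 0 _ b (s≤s b≤)))
        (Equivalence.from (bit-digitOf xs b a a≤2) x∈))

  solution⇒run : ∀ {x xs} → Linked _<_ (x ∷ xs) → sumRecip (x ∷ xs) ≡ 1ℚ → All (IsForm q) (x ∷ xs) →
                 ∃ λ ds → Run q 4 (length (x ∷ xs)) ds × x ∷ xs ≡ encode ds
  solution⇒run {x} {xs} strict reciprocals fs = ds , subst (λ n → Run q 4 n ds) weight≡ run , strict≡sort strict xs↭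
    where
    ys = x ∷ xs
    ds = decode fs
    D = 4 * q ^ length ds
    instance
      D≢0 : NonZero D
      D≢0 = m*n≢0 4 (q ^ length ds) {{_}} {{m^n≢0 q (length ds)}}
    xs↭ : ys ↭ elements q ds
    xs↭ = same-members⇒↭ (strict⇒unique strict) (elements-unique ds) (⇔.sym (∈-decode fs))
    divides-D : All (_∣ D) ys
    divides-D = All.tabulate λ x∈ → elements-divide q ds (Equivalence.from (∈-decode fs) x∈)
    weight≡ : sum (map weight ds) ≡ length ys
    weight≡ = trans (sym (length-elements q ds)) (sym (↭-length xs↭))
    run : Run q 4 (sum (map weight ds)) ds
    run with maxExponent-attained fs
    ... | a , a≤2 , x∈ = eval⇒run
      (digitsFrom-LastNonzero ys 0 (maxExponent fs) a (Equivalence.from (bit-digitOf ys (maxExponent fs) a a≤2) x∈))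
      (begin
        q * eval q ds                     ≡⟨ sum-elements q ds (<-trans z<s 1<q) ⟨
        sum (map (D ÷_) (elements q ds))  ≡⟨ sum-↭ (Permutation.map⁺ (D ÷_) xs↭) ⟨
        sum (map (D ÷_) ys)               ≡⟨ Equivalence.to (sumRecip≡1⇔ ys divides-D) reciprocals ⟩
        D                                 ∎)
      where open ≡-Reasoning

-- Opaque, so that membership goals in the enumerations below are matched against branches bs.
opaque
  branches : List (Digit × List (List Digit)) → List (List Digit)
  branches [] = []
  branches ((d , rs) ∷ bs) = map (d ∷_) rs ++ branches bs

  ∈-branches⁺ : ∀ {d rs r bs} → (d , rs) ∈ bs → r ∈ rs → d ∷ r ∈ branches bs
  ∈-branches⁺ {d} (here refl) r∈ = ∈-++⁺ˡ (∈-map⁺ (d ∷_) r∈)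
  ∈-branches⁺ {bs = (d′ , rs′) ∷ _} (there b∈) r∈ = ∈-++⁺ʳ (map (d′ ∷_) rs′) (∈-branches⁺ b∈ r∈)

  All-branches⁺ : ∀ {P : List Digit → Set} {bs} →
                  All (λ (d , rs) → All (λ r → P (d ∷ r)) rs) bs → All P (branches bs)
  All-branches⁺ {bs = []} [] = []
  All-branches⁺ {bs = (d , rs) ∷ _} (rs-ok ∷ bs-ok) = All.++⁺ (All.map⁺ rs-ok) (All-branches⁺ bs-ok)

  head∈branches : ∀ {d r bs} → d ∷ r ∈ branches bs → d ∈ map proj₁ bs
  head∈branches {bs = (d′ , rs) ∷ _} ds∈ with ∈-++⁻ (map (d′ ∷_) rs) ds∈
  ... | inj₁ ds∈ₕ with ∈-map⁻ (d′ ∷_) ds∈ₕ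
  ...   | _ , _ , refl = here refl
  head∈branches _ | inj₂ ds∈ₜ = there (head∈branches ds∈ₜ)

  unique-branches : ∀ {bs} {_ : True (unique? (map proj₁ bs))} →
                    All (λ (_ , rs) → Unique rs) bs → Unique (branches bs)
  unique-branches {bs} {distinct} = go (toWitness distinct)
    where
    go : ∀ {bs} → Unique (map proj₁ bs) → All (λ (_ , rs) → Unique rs) bs → Unique (branches bs)
    go {[]} _ _ = []
    go {(d , rs) ∷ bs} (d∉ ∷ distinct) (unique ∷ uniques) =
      Unique.++⁺ (Unique.map⁺ ∷-injectiveʳ unique) (go distinct uniques) λ (ds∈ₕ , ds∈ₜ) →
        case ∈-map⁻ (d ∷_) ds∈ₕ of λ where (_ , _ , refl) → All.lookup d∉ (head∈branches ds∈ₜ) refl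

  length-branches : ∀ bs → length (branches bs) ≡ sum (map (λ (_ , rs) → length rs) bs)
  length-branches [] = refl
  length-branches ((d , rs) ∷ bs) =
    trans (length-++ (map (d ∷_) rs)) (cong₂ _+_ (length-map (d ∷_) rs) (length-branches bs))

from0 : ℕ → List (List Digit)
from0 zero = [] ∷ []
from0 (suc _) = []

from0-sound : ∀ {q} n → All (Run q 0 n) (from0 n)
from0-sound zero = done ∷ []
from0-sound (suc n) = []

from0-unique : ∀ n → Unique (from0 n)
from0-unique zero = [] ∷ []
from0-unique (suc n) = []

from0-complete : ∀ {q n ds} → Run q 0 n ds → ds ∈ from0 n
from0-complete done = here refl

sum₃ : ∀ a b c → sum (a ∷ b ∷ c ∷ []) ≡ a + b + c
sum₃ a b c = trans (cong (λ z → a + (b + z)) (+-identityʳ c)) (sym (+-assoc a b c))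

module Base3 where

  mutual
    from9 : ℕ → List (List Digit)
    from9 (suc (suc (suc m))) = branches ((d₆ , from9 (suc m)) ∷ (d₇ , from6 m) ∷ [])
    from9 _ = []

    from6 : ℕ → List (List Digit)
    from6 (suc (suc m)) =
      branches ((d₃ , from9 m) ∷ (d₄ , from6 (suc m)) ∷ (d₅ , from3 m) ∷ (d₆ , from0 m) ∷ [])
    from6 _ = []

    from3 : ℕ → List (List Digit)
    from3 (suc (suc m)) =
      branches ((d₀ , from9 (suc (suc m))) ∷ (d₁ , from6 (suc m)) ∷ (d₂ , from3 (suc m)) ∷ (d₃ , from0 m) ∷ [])
    from3 _ = []

  from4 : ℕ → List (List Digit)
  from4 (suc (suc m)) = branches ((d₁ , from9 (suc m)) ∷ (d₂ , from6 (suc m)) ∷ (d₃ , from3 m) ∷ [])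
  from4 (suc zero) = (d₄ ∷ []) ∷ []
  from4 zero = []

  mutual
    from9-sound : ∀ n → All (Run 3 9 n) (from9 n)
    from9-sound (suc (suc (suc m))) = All-branches⁺
      ( All.map (step refl) (from9-sound (suc m))
      ∷ All.map (step refl) (from6-sound m)
      ∷ [])
    from9-sound 0 = []
    from9-sound 1 = []
    from9-sound 2 = []

    from6-sound : ∀ n → All (Run 3 6 n) (from6 n)
    from6-sound (suc (suc m)) = All-branches⁺
      ( All.map (step refl) (from9-sound m)
      ∷ All.map (step refl) (from6-sound (suc m))
      ∷ All.map (step refl) (from3-sound m)
      ∷ All.map (step refl) (from0-sound m)
      ∷ [])
    from6-sound 0 = []
    from6-sound 1 = []

    from3-sound : ∀ n → All (Run 3 3 n) (from3 n)
    from3-sound (suc (suc m)) = All-branches⁺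
      ( All.map (step refl) (from9-sound (suc (suc m)))
      ∷ All.map (step refl) (from6-sound (suc m))
      ∷ All.map (step refl) (from3-sound (suc m))
      ∷ All.map (step refl) (from0-sound m)
      ∷ [])
    from3-sound 0 = []
    from3-sound 1 = []

  from4-sound : ∀ n → All (Run 3 4 n) (from4 n)
  from4-sound (suc (suc m)) = All-branches⁺
    ( All.map (step refl) (from9-sound (suc m))
    ∷ All.map (step refl) (from6-sound (suc m))
    ∷ All.map (step refl) (from3-sound m)
    ∷ [])
  from4-sound 1 = step refl done ∷ []
  from4-sound 0 = []

  mutual
    from9-complete : ∀ {n ds} → Run 3 9 n ds → ds ∈ from9 n
    from9-complete (step {d = d₀} refl run) = ⊥-elim (unreachable run)
    from9-complete (step {d = d₁} refl run) = ⊥-elim (unreachable run)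
    from9-complete (step {d = d₂} refl run) = ⊥-elim (unreachable run)
    from9-complete (step {d = d₃} refl run) = ⊥-elim (unreachable run)
    from9-complete (step {d = d₄} refl run) = ⊥-elim (unreachable run)
    from9-complete (step {d = d₅} refl run) = ⊥-elim (unreachable run)
    from9-complete (step {d = d₆} {w = zero} refl run) with () ← from9-complete run
    from9-complete (step {d = d₆} {w = suc _} refl run) = ∈-branches⁺ (here refl) (from9-complete run)
    from9-complete (step {d = d₇} refl run) = ∈-branches⁺ (there (here refl)) (from6-complete run)

    from6-complete : ∀ {n ds} → Run 3 6 n ds → ds ∈ from6 n
    from6-complete (step {d = d₀} refl run) = ⊥-elim (unreachable run)
    from6-complete (step {d = d₁} refl run) = ⊥-elim (unreachable run)
    from6-complete (step {d = d₂} refl run) = ⊥-elim (unreachable run)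
    from6-complete (step {d = d₃} refl run) = ∈-branches⁺ (here refl) (from9-complete run)
    from6-complete (step {d = d₄} {w = zero} refl run) with () ← from6-complete run
    from6-complete (step {d = d₄} {w = suc _} refl run) = ∈-branches⁺ (there (here refl)) (from6-complete run)
    from6-complete (step {d = d₅} refl run) = ∈-branches⁺ (there (there (here refl))) (from3-complete run)
    from6-complete (step {d = d₆} refl run) = ∈-branches⁺ (there (there (there (here refl)))) (from0-complete run)
    from6-complete (step {d = d₇} () _)

    from3-complete : ∀ {n ds} → Run 3 3 n ds → ds ∈ from3 n
    from3-complete (step {d = d₀} {w = zero} refl run) with () ← from9-complete run
    from3-complete (step {d = d₀} {w = suc zero} refl run) with () ← from9-complete run
    from3-complete (step {d = d₀} {w = suc (suc _)} refl run) = ∈-branches⁺ (here refl) (from9-complete run)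
    from3-complete (step {d = d₁} {w = zero} refl run) with () ← from6-complete run
    from3-complete (step {d = d₁} {w = suc _} refl run) = ∈-branches⁺ (there (here refl)) (from6-complete run)
    from3-complete (step {d = d₂} {w = zero} refl run) with () ← from3-complete run
    from3-complete (step {d = d₂} {w = suc _} refl run) = ∈-branches⁺ (there (there (here refl))) (from3-complete run)
    from3-complete (step {d = d₃} refl run) = ∈-branches⁺ (there (there (there (here refl)))) (from0-complete run)
    from3-complete (step {d = d₄} () _)
    from3-complete (step {d = d₅} () _)
    from3-complete (step {d = d₆} () _)
    from3-complete (step {d = d₇} () _)

  from4-complete : ∀ {n ds} → Run 3 4 n ds → ds ∈ from4 n
  from4-complete (step {d = d₀} refl run) = ⊥-elim (unreachable run)
  from4-complete (step {d = d₁} {w = zero} refl run) with () ← from9-complete run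
  from4-complete (step {d = d₁} {w = suc _} refl run) = ∈-branches⁺ (here refl) (from9-complete run)
  from4-complete (step {d = d₂} {w = zero} refl run) with () ← from6-complete run
  from4-complete (step {d = d₂} {w = suc _} refl run) = ∈-branches⁺ (there (here refl)) (from6-complete run)
  from4-complete (step {d = d₃} refl run) = ∈-branches⁺ (there (there (here refl))) (from3-complete run)
  from4-complete (step {d = d₄} refl done) = here refl
  from4-complete (step {d = d₅} () _)
  from4-complete (step {d = d₆} () _)
  from4-complete (step {d = d₇} () _)

  mutual
    from9-unique : ∀ n → Unique (from9 n)
    from9-unique (suc (suc (suc m))) = unique-branches (from9-unique (suc m) ∷ from6-unique m ∷ [])
    from9-unique 0 = []
    from9-unique 1 = []
    from9-unique 2 = []

    from6-unique : ∀ n → Unique (from6 n)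
    from6-unique (suc (suc m)) =
      unique-branches (from9-unique m ∷ from6-unique (suc m) ∷ from3-unique m ∷ from0-unique m ∷ [])
    from6-unique 0 = []
    from6-unique 1 = []

    from3-unique : ∀ n → Unique (from3 n)
    from3-unique (suc (suc m)) =
      unique-branches (from9-unique (suc (suc m)) ∷ from6-unique (suc m) ∷ from3-unique (suc m) ∷ from0-unique m ∷ [])
    from3-unique 0 = []
    from3-unique 1 = []

  from4-unique : ∀ n → Unique (from4 n)
  from4-unique (suc (suc m)) = unique-branches (from9-unique (suc m) ∷ from6-unique (suc m) ∷ from3-unique m ∷ [])
  from4-unique 1 = [] ∷ []
  from4-unique 0 = []

  length-from9 : ∀ m → length (from9 (3 + m)) ≡ length (from9 (1 + m)) + length (from6 m)
  length-from9 m = trans (length-branches _) (cong (length (from9 (1 + m)) +_) (+-identityʳ _))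

  length-from6 : ∀ m → length (from6 (3 + m)) ≡ length (from9 (1 + m)) + length (from6 (2 + m)) + length (from3 (1 + m))
  length-from6 m = trans (length-branches _) (sum₃ (length (from9 (1 + m))) (length (from6 (2 + m))) (length (from3 (1 + m))))

  length-from3 : ∀ m → length (from3 (3 + m)) ≡ length (from9 (3 + m)) + length (from6 (2 + m)) + length (from3 (2 + m))
  length-from3 m = trans (length-branches _) (sum₃ (length (from9 (3 + m))) (length (from6 (2 + m))) (length (from3 (2 + m))))

  length-from4 : ∀ m → length (from4 (2 + m)) ≡ length (from9 (1 + m)) + length (from6 (1 + m)) + length (from3 m)
  length-from4 m = trans (length-branches _) (sum₃ (length (from9 (1 + m))) (length (from6 (1 + m))) (length (from3 m)))

module Base5 where

  from5 : ℕ → List (List Digit)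
  from5 (suc (suc m)) = branches ((d₄ , from5 (suc m)) ∷ (d₅ , from0 m) ∷ [])
  from5 _ = []

  from4 : ℕ → List (List Digit)
  from4 (suc (suc m)) = branches ((d₃ , from5 m) ∷ [])
  from4 (suc zero) = (d₄ ∷ []) ∷ []
  from4 zero = []

  from5-sound : ∀ n → All (Run 5 5 n) (from5 n)
  from5-sound (suc (suc m)) = All-branches⁺
    ( All.map (step refl) (from5-sound (suc m))
    ∷ All.map (step refl) (from0-sound m)
    ∷ [])
  from5-sound 0 = []
  from5-sound 1 = []

  from4-sound : ∀ n → All (Run 5 4 n) (from4 n)
  from4-sound (suc (suc m)) = All-branches⁺ (All.map (step refl) (from5-sound m) ∷ [])
  from4-sound 1 = step refl done ∷ []
  from4-sound 0 = []

  from5-complete : ∀ {n ds} → Run 5 5 n ds → ds ∈ from5 n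
  from5-complete (step {d = d₀} refl run) = ⊥-elim (unreachable run)
  from5-complete (step {d = d₁} refl run) = ⊥-elim (unreachable run)
  from5-complete (step {d = d₂} refl run) = ⊥-elim (unreachable run)
  from5-complete (step {d = d₃} refl run) = ⊥-elim (unreachable run)
  from5-complete (step {d = d₄} {w = zero} refl run) with () ← from5-complete run
  from5-complete (step {d = d₄} {w = suc _} refl run) = ∈-branches⁺ (here refl) (from5-complete run)
  from5-complete (step {d = d₅} refl run) = ∈-branches⁺ (there (here refl)) (from0-complete run)
  from5-complete (step {d = d₆} () _)
  from5-complete (step {d = d₇} () _)

  from4-complete : ∀ {n ds} → Run 5 4 n ds → ds ∈ from4 n
  from4-complete (step {d = d₀} refl run) = ⊥-elim (unreachable run)
  from4-complete (step {d = d₁} refl run) = ⊥-elim (unreachable run)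
  from4-complete (step {d = d₂} refl run) = ⊥-elim (unreachable run)
  from4-complete (step {d = d₃} refl run) = ∈-branches⁺ (here refl) (from5-complete run)
  from4-complete (step {d = d₄} refl done) = here refl
  from4-complete (step {d = d₅} () _)
  from4-complete (step {d = d₆} () _)
  from4-complete (step {d = d₇} () _)

  from5-unique : ∀ n → Unique (from5 n)
  from5-unique (suc (suc m)) = unique-branches (from5-unique (suc m) ∷ from0-unique m ∷ [])
  from5-unique 0 = []
  from5-unique 1 = []

  from4-unique : ∀ n → Unique (from4 n)
  from4-unique (suc (suc m)) = unique-branches (from5-unique m ∷ [])
  from4-unique 1 = [] ∷ []
  from4-unique 0 = []

  length-from5 : ∀ m → length (from5 (3 + m)) ≡ length (from5 (2 + m))
  length-from5 m = trans (length-branches _) (+-identityʳ _)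

  length-from4 : ∀ m → length (from4 (2 + m)) ≡ length (from5 m)
  length-from4 m = trans (length-branches _) (+-identityʳ _)

  from4-period : ∀ k → length (from4 (6 + k)) ≡ length (from4 (4 + k))
  from4-period k =
    trans (length-from4 (4 + k)) (trans (length-from5 (1 + k)) (trans (length-from5 k) (sym (length-from4 (2 + k)))))

  from5-level₀-has-1 : ∀ n → All (λ ds → T (bit (digitAt ds 0) 0)) (from5 n)
  from5-level₀-has-1 (suc (suc m)) = All-branches⁺ (All.tabulate (λ _ → tt) ∷ All.tabulate (λ _ → tt) ∷ [])
  from5-level₀-has-1 0 = []
  from5-level₀-has-1 1 = []

  from4-has-q : ∀ m → All (λ ds → T (bit (digitAt ds 1) 0)) (from4 (2 + m))
  from4-has-q m = All-branches⁺ (from5-level₀-has-1 m ∷ [])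

module Base7 where

  from7 : ℕ → List (List Digit)
  from7 (suc (suc (suc m))) = branches ((d₆ , from7 (suc m)) ∷ (d₇ , from0 m) ∷ [])
  from7 _ = []

  from4 : ℕ → List (List Digit)
  from4 (suc (suc m)) = branches ((d₃ , from7 m) ∷ [])
  from4 (suc zero) = (d₄ ∷ []) ∷ []
  from4 zero = []

  from7-sound : ∀ n → All (Run 7 7 n) (from7 n)
  from7-sound (suc (suc (suc m))) = All-branches⁺
    ( All.map (step refl) (from7-sound (suc m))
    ∷ All.map (step refl) (from0-sound m)
    ∷ [])
  from7-sound 0 = []
  from7-sound 1 = []
  from7-sound 2 = []

  from4-sound : ∀ n → All (Run 7 4 n) (from4 n)
  from4-sound (suc (suc m)) = All-branches⁺ (All.map (step refl) (from7-sound m) ∷ [])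
  from4-sound 1 = step refl done ∷ []
  from4-sound 0 = []

  from7-complete : ∀ {n ds} → Run 7 7 n ds → ds ∈ from7 n
  from7-complete (step {d = d₀} refl run) = ⊥-elim (unreachable run)
  from7-complete (step {d = d₁} refl run) = ⊥-elim (unreachable run)
  from7-complete (step {d = d₂} refl run) = ⊥-elim (unreachable run)
  from7-complete (step {d = d₃} refl run) = ⊥-elim (unreachable run)
  from7-complete (step {d = d₄} refl run) = ⊥-elim (unreachable run)
  from7-complete (step {d = d₅} refl run) = ⊥-elim (unreachable run)
  from7-complete (step {d = d₆} {w = zero} refl run) with () ← from7-complete run
  from7-complete (step {d = d₆} {w = suc _} refl run) = ∈-branches⁺ (here refl) (from7-complete run)
  from7-complete (step {d = d₇} refl run) = ∈-branches⁺ (there (here refl)) (from0-complete run)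

  from4-complete : ∀ {n ds} → Run 7 4 n ds → ds ∈ from4 n
  from4-complete (step {d = d₀} refl run) = ⊥-elim (unreachable run)
  from4-complete (step {d = d₁} refl run) = ⊥-elim (unreachable run)
  from4-complete (step {d = d₂} refl run) = ⊥-elim (unreachable run)
  from4-complete (step {d = d₃} refl run) = ∈-branches⁺ (here refl) (from7-complete run)
  from4-complete (step {d = d₄} refl done) = here refl
  from4-complete (step {d = d₅} () _)
  from4-complete (step {d = d₆} () _)
  from4-complete (step {d = d₇} () _)

  from7-unique : ∀ n → Unique (from7 n)
  from7-unique (suc (suc (suc m))) = unique-branches (from7-unique (suc m) ∷ from0-unique m ∷ [])
  from7-unique 0 = []
  from7-unique 1 = []
  from7-unique 2 = []

  from4-unique : ∀ n → Unique (from4 n)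
  from4-unique (suc (suc m)) = unique-branches (from7-unique m ∷ [])
  from4-unique 1 = [] ∷ []
  from4-unique 0 = []

  length-from7 : ∀ m → length (from7 (4 + m)) ≡ length (from7 (2 + m))
  length-from7 m = trans (length-branches _) (+-identityʳ _)

  length-from4 : ∀ m → length (from4 (2 + m)) ≡ length (from7 m)
  length-from4 m = trans (length-branches _) (+-identityʳ _)

  from4-period : ∀ k → length (from4 (6 + k)) ≡ length (from4 (4 + k))
  from4-period k = trans (length-from4 (4 + k)) (trans (length-from7 k) (sym (length-from4 (2 + k))))

  from7-level₀-has-1 : ∀ n → All (λ ds → T (bit (digitAt ds 0) 0)) (from7 n)
  from7-level₀-has-1 (suc (suc (suc m))) = All-branches⁺ (All.tabulate (λ _ → tt) ∷ All.tabulate (λ _ → tt) ∷ [])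
  from7-level₀-has-1 0 = []
  from7-level₀-has-1 1 = []
  from7-level₀-has-1 2 = []

  from4-has-q : ∀ m → All (λ ds → T (bit (digitAt ds 1) 0)) (from4 (2 + m))
  from4-has-q m = All-branches⁺ (from7-level₀-has-1 m ∷ [])

-- A linear recurrence of order six

Recurrent : (ℕ → ℕ) → Set
Recurrent f = ∀ j → f (6 + j) + f (3 + j) + f j ≡ 2 * f (5 + j) + f (2 + j) + f (1 + j)

+-interchange₃ : ∀ a b c a′ b′ c′ → (a + a′) + (b + b′) + (c + c′) ≡ (a + b + c) + (a′ + b′ + c′)
+-interchange₃ = solve-∀

*2-interchange₃ : ∀ a b c a′ b′ c′ →
                  2 * (a + a′) + (b + b′) + (c + c′) ≡ (2 * a + b + c) + (2 * a′ + b′ + c′)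
*2-interchange₃ = solve-∀

recurrent-+ : ∀ {f g} → Recurrent f → Recurrent g → Recurrent (λ j → f j + g j)
recurrent-+ {f} {g} rec-f rec-g j =
  trans (+-interchange₃ (f (6 + j)) (f (3 + j)) (f j) (g (6 + j)) (g (3 + j)) (g j))
  (trans (cong₂ _+_ (rec-f j) (rec-g j))
  (sym (*2-interchange₃ (f (5 + j)) (f (2 + j)) (f (1 + j)) (g (5 + j)) (g (2 + j)) (g (1 + j)))))

recurrent-resp : ∀ {f g} → (∀ j → f j ≡ g j) → Recurrent f → Recurrent g
recurrent-resp {f} {g} f≗g rec-f j = begin
  g (6 + j) + g (3 + j) + g j              ≡⟨ cong₂ _+_ (cong₂ _+_ (f≗g (6 + j)) (f≗g (3 + j))) (f≗g j) ⟨
  f (6 + j) + f (3 + j) + f j              ≡⟨ rec-f j ⟩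
  2 * f (5 + j) + f (2 + j) + f (1 + j)
    ≡⟨ cong₂ _+_ (cong₂ _+_ (cong (2 *_) (f≗g (5 + j))) (f≗g (2 + j))) (f≗g (1 + j)) ⟩
  2 * g (5 + j) + g (2 + j) + g (1 + j)    ∎
  where open ≡-Reasoning

recurrent-cancel : ∀ {f g h} → (∀ j → f j + g j ≡ h j) → Recurrent g → Recurrent h → Recurrent f
recurrent-cancel {f} {g} {h} f+g≗h rec-g rec-h j = +-cancelʳ-≡ (g (6 + j) + g (3 + j) + g j) _ _ (begin
  f (6 + j) + f (3 + j) + f j + (g (6 + j) + g (3 + j) + g j)
    ≡⟨ +-interchange₃ (f (6 + j)) (f (3 + j)) (f j) (g (6 + j)) (g (3 + j)) (g j) ⟨
  (f (6 + j) + g (6 + j)) + (f (3 + j) + g (3 + j)) + (f j + g j)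
    ≡⟨ recurrent-resp (λ i → sym (f+g≗h i)) rec-h j ⟩
  2 * (f (5 + j) + g (5 + j)) + (f (2 + j) + g (2 + j)) + (f (1 + j) + g (1 + j))
    ≡⟨ *2-interchange₃ (f (5 + j)) (f (2 + j)) (f (1 + j)) (g (5 + j)) (g (2 + j)) (g (1 + j)) ⟩
  2 * f (5 + j) + f (2 + j) + f (1 + j) + (2 * g (5 + j) + g (2 + j) + g (1 + j))
    ≡⟨ cong (2 * f (5 + j) + f (2 + j) + f (1 + j) +_) (rec-g j) ⟨
  2 * f (5 + j) + f (2 + j) + f (1 + j) + (g (6 + j) + g (3 + j) + g j) ∎)
  where open ≡-Reasoning

recurrent-unique : ∀ {f g} → Recurrent f → Recurrent g →
                   f 0 ≡ g 0 → f 1 ≡ g 1 → f 2 ≡ g 2 → f 3 ≡ g 3 → f 4 ≡ g 4 → f 5 ≡ g 5 →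
                   ∀ j → f j ≡ g j
recurrent-unique {f} {g} rec-f rec-g e₀ e₁ e₂ e₃ e₄ e₅ j = proj₁ (window j)
  where
  Window : ℕ → Set
  Window j = f j ≡ g j × f (1 + j) ≡ g (1 + j) × f (2 + j) ≡ g (2 + j) ×
             f (3 + j) ≡ g (3 + j) × f (4 + j) ≡ g (4 + j) × f (5 + j) ≡ g (5 + j)
  window : ∀ j → Window j
  window zero = e₀ , e₁ , e₂ , e₃ , e₄ , e₅
  window (suc j) with window j
  ... | a₀ , a₁ , a₂ , a₃ , a₄ , a₅ = a₁ , a₂ , a₃ , a₄ , a₅ , +-cancelʳ-≡ (f (3 + j) + f j) _ _ (begin
    f (6 + j) + (f (3 + j) + f j)            ≡⟨ +-assoc (f (6 + j)) _ _ ⟨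
    f (6 + j) + f (3 + j) + f j              ≡⟨ rec-f j ⟩
    2 * f (5 + j) + f (2 + j) + f (1 + j)    ≡⟨ cong₂ _+_ (cong₂ _+_ (cong (2 *_) a₅) a₂) a₁ ⟩
    2 * g (5 + j) + g (2 + j) + g (1 + j)    ≡⟨ rec-g j ⟨
    g (6 + j) + g (3 + j) + g j              ≡⟨ +-assoc (g (6 + j)) _ _ ⟩
    g (6 + j) + (g (3 + j) + g j)            ≡⟨ cong (g (6 + j) +_) (cong₂ _+_ a₃ a₀) ⟨
    g (6 + j) + (f (3 + j) + f j)            ∎)
    where open ≡-Reasoning

-- In the first lemma xᵢ, yᵢ, zᵢ stand for the numbers of runs of weight m + i from the residues
-- 9, 6, 3, in the second aᵢ, bᵢ, cᵢ for α, β, γ below at m + i. Matching the hypotheses with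
-- refl eliminates the values they define, leaving a polynomial identity in the free ones; the
-- list constructors are qualified because overloaded ones make the solver macro loop.
residue-system⇒recurrence : ∀ {x₀ x₁ x₂ x₃ x₄ x₅ x₆ y₀ y₁ y₂ y₃ z₀ z₁} →
  x₃ ≡ x₁ + y₀ → x₄ ≡ x₂ + y₁ → x₅ ≡ x₃ + y₂ → x₆ ≡ x₄ + y₃ →
  y₂ ≡ x₀ + y₁ + z₀ → y₃ ≡ x₁ + y₂ + z₁ → z₁ ≡ x₁ + y₀ + z₀ →
  x₆ + x₃ + x₀ ≡ 2 * x₅ + x₂ + x₁
residue-system⇒recurrence {x₀} {x₁} {x₂} {y₀ = y₀} {y₁} {z₀ = z₀} refl refl refl refl refl refl refl =
  solve (x₀ L.∷ x₁ L.∷ x₂ L.∷ y₀ L.∷ y₁ L.∷ z₀ L.∷ L.[])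

paper-system⇒recurrence : ∀ {a₂ a₃ a₄ a₅ a₆ a₇ a₈ a₉ b₀ b₁ b₂ b₃ b₄ b₅ b₆ b₇ c₀ c₁ c₂} →
  a₄ ≡ a₃ + b₂ → a₅ ≡ a₄ + b₃ → a₆ ≡ a₅ + b₄ → a₇ ≡ a₆ + b₅ → a₈ ≡ a₇ + b₆ → a₉ ≡ a₈ + b₇ →
  b₅ ≡ b₄ + a₄ + a₂ + c₀ + b₀ → b₆ ≡ b₅ + a₅ + a₃ + c₁ + b₁ → b₇ ≡ b₆ + a₆ + a₄ + c₂ + b₂ →
  c₂ ≡ a₂ + c₀ + b₀ →
  a₉ + a₆ + a₃ ≡ 2 * a₈ + a₅ + a₄
paper-system⇒recurrence {a₂} {a₃} {b₀ = b₀} {b₁} {b₂} {b₃} {b₄} {c₀ = c₀} {c₁}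
  refl refl refl refl refl refl refl refl refl refl =
  solve (a₂ L.∷ a₃ L.∷ b₀ L.∷ b₁ L.∷ b₂ L.∷ b₃ L.∷ b₄ L.∷ c₀ L.∷ c₁ L.∷ L.[])

-- The seven sequences of the paper enter their recurrences only through these three sums.
α β γ : ℕ → ℕ
α n = ast n + dia n
β n = tri n + sq n + St1 n + St2 n + St n
γ n = α n + t n + p n

α-step : ∀ k → α (5 + k) ≡ α (4 + k) + β (3 + k)
α-step k = cong (_+ β (3 + k)) (+-identityʳ (α (4 + k)))

β-step : ∀ k → β (9 + k) ≡ β (8 + k) + α (8 + k) + α (6 + k) + γ (4 + k) + β (4 + k)
β-step k =
  cong₂ (λ x y → β (8 + k) + α (8 + k) + x + y + β (4 + k)) (+-identityʳ (α (6 + k))) (+-identityʳ (γ (4 + k)))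

γ-step : ∀ k → γ (6 + k) ≡ α (6 + k) + γ (4 + k) + β (4 + k)
γ-step k = cong (λ x → α (6 + k) + x + β (4 + k)) (+-identityʳ (γ (4 + k)))

paper-split : ∀ n → tri n + sq n + ast n + dia n + St1 n + St2 n + St n ≡ β n + α n
paper-split n = regroup (tri n) (sq n) (ast n) (dia n) (St1 n) (St2 n) (St n)
  where
  regroup : ∀ a b c d e f g → a + b + c + d + e + f + g ≡ a + b + e + f + g + (c + d)
  regroup = solve-∀

α-recurrent : Recurrent (λ j → α (7 + j))
α-recurrent j = paper-system⇒recurrence (α-step (3 + j)) (α-step (4 + j)) (α-step (5 + j)) (α-step (6 + j))
  (α-step (7 + j)) (α-step (8 + j)) (β-step j) (β-step (1 + j)) (β-step (2 + j)) (γ-step j)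

β-recurrent : Recurrent (λ j → β (7 + j))
β-recurrent = recurrent-cancel {λ j → β (7 + j)} {λ j → α (8 + j)} {λ j → α (9 + j)} β+α≡α
  (λ j → α-recurrent (1 + j)) (λ j → α-recurrent (2 + j))
  where
  β+α≡α : ∀ j → β (7 + j) + α (8 + j) ≡ α (9 + j)
  β+α≡α j = trans (+-comm (β (7 + j)) (α (8 + j))) (sym (α-step (4 + j)))

paper-recurrent : Recurrent (λ j → β (7 + j) + α (7 + j))
paper-recurrent = recurrent-+ {λ j → β (7 + j)} {λ j → α (7 + j)} β-recurrent α-recurrent

module Count3 where
  open Base3

  #9 #6 #3 #4 : ℕ → ℕ
  #9 n = length (from9 n)
  #6 n = length (from6 n)
  #3 n = length (from3 n)
  #4 n = length (from4 n)

  #9-recurrent : Recurrent (λ j → #9 (2 + j))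
  #9-recurrent j = residue-system⇒recurrence (length-from9 (2 + j)) (length-from9 (3 + j)) (length-from9 (4 + j))
    (length-from9 (5 + j)) (length-from6 (1 + j)) (length-from6 (2 + j)) (length-from3 j)

  #6-recurrent : Recurrent (λ j → #6 (2 + j))
  #6-recurrent = recurrent-cancel {λ j → #6 (2 + j)} {λ j → #9 (3 + j)} {λ j → #9 (5 + j)} #6+#9≡#9
    (λ j → #9-recurrent (1 + j)) (λ j → #9-recurrent (3 + j))
    where
    #6+#9≡#9 : ∀ j → #6 (2 + j) + #9 (3 + j) ≡ #9 (5 + j)
    #6+#9≡#9 j = trans (+-comm (#6 (2 + j)) (#9 (3 + j))) (sym (length-from9 (2 + j)))

  #3-recurrent : Recurrent (λ j → #3 (2 + j))
  #3-recurrent = recurrent-cancel {λ j → #3 (2 + j)} {λ j → #9 (2 + j) + #6 (3 + j)} {λ j → #6 (4 + j)} #3+#9+#6≡#6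
    (recurrent-+ {λ j → #9 (2 + j)} {λ j → #6 (3 + j)} #9-recurrent (λ j → #6-recurrent (1 + j)))
    (λ j → #6-recurrent (2 + j))
    where
    #3+#9+#6≡#6 : ∀ j → #3 (2 + j) + (#9 (2 + j) + #6 (3 + j)) ≡ #6 (4 + j)
    #3+#9+#6≡#6 j = trans (+-comm (#3 (2 + j)) _) (sym (length-from6 (1 + j)))

  #4-recurrent : Recurrent (λ j → #4 (7 + j))
  #4-recurrent = recurrent-resp (λ j → sym (length-from4 (5 + j)))
    (recurrent-+ {λ j → #9 (6 + j) + #6 (6 + j)} {λ j → #3 (5 + j)}
      (recurrent-+ {λ j → #9 (6 + j)} {λ j → #6 (6 + j)} (λ j → #9-recurrent (4 + j)) (λ j → #6-recurrent (4 + j)))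
      (λ j → #3-recurrent (3 + j)))

opaque
  unfolding branches

  base3-count : ∀ j → Count3.#4 (7 + j) ≡ β (7 + j) + α (7 + j)
  base3-count = recurrent-unique Count3.#4-recurrent paper-recurrent refl refl refl refl refl refl

  parity-count : ∀ k → length (Base5.from4 (4 + k)) + length (Base7.from4 (4 + k)) ≡ parityTerm (4 + k)
  parity-count 0 = refl
  parity-count 1 = refl
  parity-count (suc (suc k)) = trans (cong₂ _+_ (Base5.from4-period k) (Base7.from4-period k)) (parity-count k)

¬IsForm : ∀ {q x} → x ≢ 1 → x ≢ 2 → x ≢ 4 → ¬ q ∣ x → ¬ IsForm q x
¬IsForm ≢1 _ _ _ (0 , 0 , _ , eq) = ≢1 eq
¬IsForm _ ≢2 _ _ (1 , 0 , _ , eq) = ≢2 eq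
¬IsForm _ _ ≢4 _ (2 , 0 , _ , eq) = ≢4 eq
¬IsForm _ _ _ _ (suc (suc (suc _)) , _ , s≤s (s≤s ()) , _)
¬IsForm {q} _ _ _ q∤x (a , suc b , _ , eq) = q∤x (divides (2 ^ a * q ^ b) (trans eq (regroup (2 ^ a) q (q ^ b))))
  where
  regroup : ∀ A q Q → A * (q * Q) ≡ A * Q * q
  regroup = solve-∀

5∉3-form : ¬ IsForm 3 5
5∉3-form = ¬IsForm (λ ()) (λ ()) (λ ()) (from-no (3 ∣? 5))

7∉3-form : ¬ IsForm 3 7
7∉3-form = ¬IsForm (λ ()) (λ ()) (λ ()) (from-no (3 ∣? 7))

5∉7-form : ¬ IsForm 7 5
5∉7-form = ¬IsForm (λ ()) (λ ()) (λ ()) (from-no (7 ∣? 5))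

module Odd3 = OddBase {3} refl (s≤s (s≤s z≤n))
module Odd5 = OddBase {5} refl (s≤s (s≤s z≤n))
module Odd7 = OddBase {7} refl (s≤s (s≤s z≤n))

solutions : ℕ → List (List ℕ)
solutions n = map Odd3.encode (Base3.from4 n) ++ map Odd5.encode (Base5.from4 n) ++ map Odd7.encode (Base7.from4 n)

solutions-sound : ∀ n {xs} → xs ∈ solutions n → IsSolution n xs
solutions-sound n xs∈ with ∈-++⁻ (map Odd3.encode (Base3.from4 n)) xs∈
... | inj₁ xs∈₃ with ∈-map⁻ Odd3.encode xs∈₃
...   | ds , ds∈ , refl = Odd3.run⇒solution (from-yes (prime? 3)) (All.lookup (Base3.from4-sound n) ds∈)
solutions-sound n xs∈ | inj₂ xs∈′ with ∈-++⁻ (map Odd5.encode (Base5.from4 n)) xs∈′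
... | inj₁ xs∈₅ with ∈-map⁻ Odd5.encode xs∈₅
...   | ds , ds∈ , refl = Odd5.run⇒solution (from-yes (prime? 5)) (All.lookup (Base5.from4-sound n) ds∈)
solutions-sound n xs∈ | inj₂ xs∈′ | inj₂ xs∈₇ with ∈-map⁻ Odd7.encode xs∈₇
...   | ds , ds∈ , refl = Odd7.run⇒solution (from-yes (prime? 7)) (All.lookup (Base7.from4-sound n) ds∈)

∈-solutions₃ : ∀ {n ds} → Run 3 4 n ds → Odd3.encode ds ∈ solutions n
∈-solutions₃ run = ∈-++⁺ˡ (∈-map⁺ Odd3.encode (Base3.from4-complete run))

∈-solutions₅ : ∀ {n ds} → Run 5 4 n ds → Odd5.encode ds ∈ solutions n
∈-solutions₅ {n} run =
  ∈-++⁺ʳ (map Odd3.encode (Base3.from4 n)) (∈-++⁺ˡ (∈-map⁺ Odd5.encode (Base5.from4-complete run)))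

∈-solutions₇ : ∀ {n ds} → Run 7 4 n ds → Odd7.encode ds ∈ solutions n
∈-solutions₇ {n} run = ∈-++⁺ʳ (map Odd3.encode (Base3.from4 n))
  (∈-++⁺ʳ (map Odd5.encode (Base5.from4 n)) (∈-map⁺ Odd7.encode (Base7.from4-complete run)))

solutions-complete : ∀ {n xs} → 9 ≤ n → IsSolution n xs → xs ∈ solutions n
solutions-complete {xs = []} 9≤n (len , _) = contradiction (subst (9 ≤_) (sym len) 9≤n) λ ()
solutions-complete {n} {x ∷ xs} 9≤n (len , strict , _ , reciprocals , q , q-prime , q-odd , forms) =
  in-base q q-prime q-odd forms
  where
  Decoded : ℕ → (List Digit → List ℕ) → Set
  Decoded q encode = ∃ λ ds → Run q 4 (length (x ∷ xs)) ds × x ∷ xs ≡ encode ds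
  listed : ∀ {q encode} → (∀ {ds} → Run q 4 n ds → encode ds ∈ solutions n) →
           Decoded q encode → x ∷ xs ∈ solutions n
  listed ∈-solutions (ds , run , eq) =
    subst (_∈ solutions n) (sym eq) (∈-solutions (subst (λ m → Run _ 4 m ds) len run))
  in-base : ∀ q → Prime q → q % 2 ≡ 1 → All (IsForm q) (x ∷ xs) → x ∷ xs ∈ solutions n
  in-base 3 _ _ forms = listed ∈-solutions₃ (Odd3.solution⇒run strict reciprocals forms)
  in-base 5 _ _ forms = listed ∈-solutions₅ (Odd5.solution⇒run strict reciprocals forms)
  in-base 7 _ _ forms = listed ∈-solutions₇ (Odd7.solution⇒run strict reciprocals forms)
  in-base (suc (suc (suc (suc (suc (suc (suc (suc (suc p))))))))) _ q-odd forms =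
    let (_ , run , _) = OddBase.solution⇒run q-odd (s≤s (s≤s z≤n)) strict reciprocals forms
    in contradiction (≤-trans 9≤n (subst (_≤ 3) len (large-base-weight (m≤m+n 8 p) run))) (from-no (9 ≤? 3))
  in-base 1 q-prime _ _ = ⊥-elim (NonTrivial.nonTrivial (prime⇒nonTrivial q-prime))
  in-base 0 _ () _
  in-base 2 _ () _
  in-base 4 _ () _
  in-base 6 _ () _
  in-base 8 _ () _

solutions-unique : ∀ m → Unique (solutions (2 + m))
solutions-unique m = Unique.++⁺ unique₃ (Unique.++⁺ unique₅ unique₇ disjoint₅₇) disjoint₃
  where
  L₃ = map Odd3.encode (Base3.from4 (2 + m))
  L₅ = map Odd5.encode (Base5.from4 (2 + m))
  L₇ = map Odd7.encode (Base7.from4 (2 + m))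
  unique₃ = Odd3.encode-unique (Base3.from4-sound (2 + m)) (Base3.from4-unique (2 + m))
  unique₅ = Odd5.encode-unique (Base5.from4-sound (2 + m)) (Base5.from4-unique (2 + m))
  unique₇ = Odd7.encode-unique (Base7.from4-sound (2 + m)) (Base7.from4-unique (2 + m))
  5∈ : ∀ {xs} → xs ∈ L₅ → 5 ∈ xs
  5∈ xs∈ with ∈-map⁻ Odd5.encode xs∈
  ... | ds , ds∈ , refl = Odd5.base∈encode ds (All.lookup (Base5.from4-has-q m) ds∈)
  7∈ : ∀ {xs} → xs ∈ L₇ → 7 ∈ xs
  7∈ xs∈ with ∈-map⁻ Odd7.encode xs∈
  ... | ds , ds∈ , refl = Odd7.base∈encode ds (All.lookup (Base7.from4-has-q m) ds∈)
  disjoint₅₇ : ∀ {xs} → ¬ (xs ∈ L₅ × xs ∈ L₇)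
  disjoint₅₇ (xs∈₅ , xs∈₇) with ∈-map⁻ Odd7.encode xs∈₇
  ... | ds , _ , refl = 5∉7-form (All.lookup (Odd7.encode-forms ds) (5∈ xs∈₅))
  disjoint₃ : ∀ {xs} → ¬ (xs ∈ L₃ × xs ∈ L₅ ++ L₇)
  disjoint₃ (xs∈₃ , xs∈₅₇) with ∈-map⁻ Odd3.encode xs∈₃
  ... | ds , _ , refl with ∈-++⁻ L₅ xs∈₅₇
  ...   | inj₁ xs∈₅ = 5∉3-form (All.lookup (Odd3.encode-forms ds) (5∈ xs∈₅))
  ...   | inj₂ xs∈₇ = 7∉3-form (All.lookup (Odd3.encode-forms ds) (7∈ xs∈₇))

length-solutions : ∀ n → length (solutions n) ≡ Count3.#4 n + (length (Base5.from4 n) + length (Base7.from4 n))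
length-solutions n = begin
  length (L₃ ++ L₅ ++ L₇)              ≡⟨ length-++ L₃ ⟩
  length L₃ + length (L₅ ++ L₇)        ≡⟨ cong (length L₃ +_) (length-++ L₅) ⟩
  length L₃ + (length L₅ + length L₇)
    ≡⟨ cong₂ _+_ (length-map Odd3.encode (Base3.from4 n))
                 (cong₂ _+_ (length-map Odd5.encode (Base5.from4 n)) (length-map Odd7.encode (Base7.from4 n))) ⟩
  Count3.#4 n + (length (Base5.from4 n) + length (Base7.from4 n))  ∎
  where
  L₃ = map Odd3.encode (Base3.from4 n)
  L₅ = map Odd5.encode (Base5.from4 n)
  L₇ = map Odd7.encode (Base7.from4 n)
  open ≡-Reasoning

solutions-count : ∀ k → length (solutions (9 + k)) ≡ formula (9 + k)
solutions-count k = trans (length-solutions (9 + k))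
  (cong₂ _+_ (trans (base3-count (2 + k)) (sym (paper-split (9 + k)))) (parity-count (5 + k)))

theorem2 : (n : ℕ) → 9 ≤ n →
    Σ (List (List ℕ)) (λ L →
      Unique L
      × ((xs : List ℕ) → (xs ∈ L) ⇔ IsSolution n xs)
      × length L ≡ formula n)
theorem2 n 9≤n with m≤n⇒∃[o]m+o≡n 9≤n
... | k , refl = solutions (9 + k) , solutions-unique (7 + k) ,
  (λ xs → mk⇔ (solutions-sound (9 + k)) (solutions-complete 9≤n)) , solutions-count k
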